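{- $\neg (\sim A)^{M}\leftrightarrow_{\mathsf{IL}}\neg\neg A^{M}$.
   Context: In classical logic the negations of atomic formulas $\bar P$ are taken as primitive, and formulas are built from atoms $P$, negated atoms $\bar P$ using $\wedge,\vee,\forall,\exists$. The formula $\sim A$ is obtained from $A$ by replacing $\wedge$, $\forall$, $P$ respectively by $\vee$, $\exists$, $\bar P$ and conversely. Avigad's translation $A^{M}$ into intuitionistic logic IL (where $\neg B$ abbreviates $B\to\bot$) is defined by: $P^{M}:\equiv P$ ($P$ atomic), $\bar P^{M}:\equiv\neg P$, $(A\vee B)^{M}:\equiv A^{M}\vee B^{M}$, $(\exists xA)^{M}:\equiv\exists xA^{M}$, $(A\wedge B)^{M}:\equiv\neg(\sim A\vee\sim B)^{M}$, $(\forall xA)^{M}:\equiv\neg(\exists x\sim A)^{M}$. $\leftrightarrow_{\mathsf{IL}}$ denotes equivalence provable in IL. -}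

module Defs where

open import Data.Nat using (ℕ; zero; suc)
open import Data.Fin using (Fin; zero; suc)
open import Data.Vec using (Vec; []; _∷_)
open import Data.List using (List; []; _∷_; map)
open import Data.List.Membership.Propositional using (_∈_)
open import Relation.Binary.PropositionalEquality using (_≡_; refl; cong; cong₂)

record Signature : Set₁ where
  field
    Fun    : Set
    farity : Fun → ℕ
    Pred   : Set
    parity : Pred → ℕ

module Syntax (S : Signature) where
  open Signature S

  data Tm (n : ℕ) : Set where
    var : Fin n → Tm n
    fun : (f : Fun) → Vec (Tm n) (farity f) → Tm n

  -- Classical formulas (negation normal form): atoms, negated atoms
  -- (primitive), ∧, ∨, ∀, ∃.
  data CFm (n : ℕ) : Set where
    pos  : (P : Pred) → Vec (Tm n) (parity P) → CFm n
    neg  : (P : Pred) → Vec (Tm n) (parity P) → CFm n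
    _∧ᶜ_ : CFm n → CFm n → CFm n
    _∨ᶜ_ : CFm n → CFm n → CFm n
    ∀ᶜ   : CFm (suc n) → CFm n
    ∃ᶜ   : CFm (suc n) → CFm n

  ∼_ : ∀ {n} → CFm n → CFm n
  ∼ pos P ts = neg P ts
  ∼ neg P ts = pos P ts
  ∼ (A ∧ᶜ B) = (∼ A) ∨ᶜ (∼ B)
  ∼ (A ∨ᶜ B) = (∼ A) ∧ᶜ (∼ B)
  ∼ ∀ᶜ A = ∃ᶜ (∼ A)
  ∼ ∃ᶜ A = ∀ᶜ (∼ A)

  ∼∼ : ∀ {n} (A : CFm n) → ∼ (∼ A) ≡ A
  ∼∼ (pos P ts) = refl
  ∼∼ (neg P ts) = refl
  ∼∼ (A ∧ᶜ B) = cong₂ _∧ᶜ_ (∼∼ A) (∼∼ B)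
  ∼∼ (A ∨ᶜ B) = cong₂ _∨ᶜ_ (∼∼ A) (∼∼ B)
  ∼∼ (∀ᶜ A) = cong ∀ᶜ (∼∼ A)
  ∼∼ (∃ᶜ A) = cong ∃ᶜ (∼∼ A)

  infixr 5 _⇒_
  data Fm (n : ℕ) : Set where
    atom : (P : Pred) → Vec (Tm n) (parity P) → Fm n
    ⊥̇    : Fm n
    _∧̇_  : Fm n → Fm n → Fm n
    _∨̇_  : Fm n → Fm n → Fm n
    _⇒_  : Fm n → Fm n → Fm n
    ∀̇    : Fm (suc n) → Fm n
    ∃̇    : Fm (suc n) → Fm n

  ¬̇_ : ∀ {n} → Fm n → Fm n
  ¬̇ B = B ⇒ ⊥̇

  _⇔̇_ : ∀ {n} → Fm n → Fm n → Fm n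
  A ⇔̇ B = (A ⇒ B) ∧̇ (B ⇒ A)

  -- The clauses for ∧ and ∀ refer to (∼A)^M,
  -- which is not structurally recursive; we therefore define M together
  -- with M∼ A := (∼A)^M, and prove below that the defining clauses of the
  -- paper hold (M-∧, M-∀).
  mutual
    M : ∀ {n} → CFm n → Fm n
    M (pos P ts) = atom P ts
    M (neg P ts) = ¬̇ atom P ts
    M (A ∨ᶜ B)   = M A ∨̇ M B
    M (∃ᶜ A)     = ∃̇ (M A)
    M (A ∧ᶜ B)   = ¬̇ (M∼ A ∨̇ M∼ B)
    M (∀ᶜ A)     = ¬̇ (∃̇ (M∼ A))

    M∼ : ∀ {n} → CFm n → Fm n
    M∼ (pos P ts) = ¬̇ atom P ts
    M∼ (neg P ts) = atom P ts
    M∼ (A ∧ᶜ B)   = M∼ A ∨̇ M∼ B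
    M∼ (A ∨ᶜ B)   = ¬̇ (M A ∨̇ M B)
    M∼ (∀ᶜ A)     = ∃̇ (M∼ A)
    M∼ (∃ᶜ A)     = ¬̇ (∃̇ (M A))

  mutual
    M∼-correct : ∀ {n} (A : CFm n) → M∼ A ≡ M (∼ A)
    M∼-correct (pos P ts) = refl
    M∼-correct (neg P ts) = refl
    M∼-correct (A ∧ᶜ B) = cong₂ _∨̇_ (M∼-correct A) (M∼-correct B)
    M∼-correct (A ∨ᶜ B) = cong₂ (λ X Y → ¬̇ (X ∨̇ Y)) (M∼∼ A) (M∼∼ B)
    M∼-correct (∀ᶜ A) = cong ∃̇ (M∼-correct A)
    M∼-correct (∃ᶜ A) = cong (λ X → ¬̇ (∃̇ X)) (M∼∼ A)

    M∼∼ : ∀ {n} (A : CFm n) → M A ≡ M∼ (∼ A)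
    M∼∼ (pos P ts) = refl
    M∼∼ (neg P ts) = refl
    M∼∼ (A ∧ᶜ B) = cong₂ (λ X Y → ¬̇ (X ∨̇ Y)) (M∼-correct A) (M∼-correct B)
    M∼∼ (A ∨ᶜ B) = cong₂ _∨̇_ (M∼∼ A) (M∼∼ B)
    M∼∼ (∀ᶜ A) = cong (λ X → ¬̇ (∃̇ X)) (M∼-correct A)
    M∼∼ (∃ᶜ A) = cong ∃̇ (M∼∼ A)

  M-∧ : ∀ {n} (A B : CFm n) → M (A ∧ᶜ B) ≡ ¬̇ (M ((∼ A) ∨ᶜ (∼ B)))
  M-∧ A B = cong₂ (λ X Y → ¬̇ (X ∨̇ Y)) (M∼-correct A) (M∼-correct B)

  M-∀ : ∀ {n} (A : CFm (suc n)) → M (∀ᶜ A) ≡ ¬̇ (M (∃ᶜ (∼ A)))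
  M-∀ A = cong (λ X → ¬̇ (∃̇ X)) (M∼-correct A)

  Ren : ℕ → ℕ → Set
  Ren n m = Fin n → Fin m

  liftR : ∀ {n m} → Ren n m → Ren (suc n) (suc m)
  liftR ρ zero = zero
  liftR ρ (suc i) = suc (ρ i)

  mutual
    renT : ∀ {n m} → Ren n m → Tm n → Tm m
    renT ρ (var i) = var (ρ i)
    renT ρ (fun f ts) = fun f (renTs ρ ts)

    renTs : ∀ {n m k} → Ren n m → Vec (Tm n) k → Vec (Tm m) k
    renTs ρ [] = []
    renTs ρ (t ∷ ts) = renT ρ t ∷ renTs ρ ts

  renF : ∀ {n m} → Ren n m → Fm n → Fm m
  renF ρ (atom P ts) = atom P (renTs ρ ts)
  renF ρ ⊥̇ = ⊥̇
  renF ρ (A ∧̇ B) = renF ρ A ∧̇ renF ρ B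
  renF ρ (A ∨̇ B) = renF ρ A ∨̇ renF ρ B
  renF ρ (A ⇒ B) = renF ρ A ⇒ renF ρ B
  renF ρ (∀̇ A) = ∀̇ (renF (liftR ρ) A)
  renF ρ (∃̇ A) = ∃̇ (renF (liftR ρ) A)

  wkF : ∀ {n} → Fm n → Fm (suc n)
  wkF = renF suc

  Sub : ℕ → ℕ → Set
  Sub n m = Fin n → Tm m

  liftS : ∀ {n m} → Sub n m → Sub (suc n) (suc m)
  liftS σ zero = var zero
  liftS σ (suc i) = renT suc (σ i)

  mutual
    subT : ∀ {n m} → Sub n m → Tm n → Tm m
    subT σ (var i) = σ i
    subT σ (fun f ts) = fun f (subTs σ ts)

    subTs : ∀ {n m k} → Sub n m → Vec (Tm n) k → Vec (Tm m) k
    subTs σ [] = []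
    subTs σ (t ∷ ts) = subT σ t ∷ subTs σ ts

  subF : ∀ {n m} → Sub n m → Fm n → Fm m
  subF σ (atom P ts) = atom P (subTs σ ts)
  subF σ ⊥̇ = ⊥̇
  subF σ (A ∧̇ B) = subF σ A ∧̇ subF σ B
  subF σ (A ∨̇ B) = subF σ A ∨̇ subF σ B
  subF σ (A ⇒ B) = subF σ A ⇒ subF σ B
  subF σ (∀̇ A) = ∀̇ (subF (liftS σ) A)
  subF σ (∃̇ A) = ∃̇ (subF (liftS σ) A)

  sub0 : ∀ {n} → Tm n → Sub (suc n) n
  sub0 t zero = t
  sub0 t (suc i) = var i

  _[_] : ∀ {n} → Fm (suc n) → Tm n → Fm n
  A [ t ] = subF (sub0 t) A

  infix 3 _⊢_
  data _⊢_ {n : ℕ} (Γ : List (Fm n)) : Fm n → Set where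
    hyp  : ∀ {A} → A ∈ Γ → Γ ⊢ A
    ⊥E   : ∀ {A} → Γ ⊢ ⊥̇ → Γ ⊢ A
    ∧I   : ∀ {A B} → Γ ⊢ A → Γ ⊢ B → Γ ⊢ A ∧̇ B
    ∧E₁  : ∀ {A B} → Γ ⊢ A ∧̇ B → Γ ⊢ A
    ∧E₂  : ∀ {A B} → Γ ⊢ A ∧̇ B → Γ ⊢ B
    ∨I₁  : ∀ {A B} → Γ ⊢ A → Γ ⊢ A ∨̇ B
    ∨I₂  : ∀ {A B} → Γ ⊢ B → Γ ⊢ A ∨̇ B
    ∨E   : ∀ {A B C} → Γ ⊢ A ∨̇ B → (A ∷ Γ) ⊢ C → (B ∷ Γ) ⊢ C → Γ ⊢ C
    ⇒I   : ∀ {A B} → (A ∷ Γ) ⊢ B → Γ ⊢ A ⇒ B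
    ⇒E   : ∀ {A B} → Γ ⊢ A ⇒ B → Γ ⊢ A → Γ ⊢ B
    ∀I   : ∀ {A} → map wkF Γ ⊢ A → Γ ⊢ ∀̇ A
    ∀E   : ∀ {A} → Γ ⊢ ∀̇ A → (t : Tm n) → Γ ⊢ A [ t ]
    ∃I   : ∀ {A} (t : Tm n) → Γ ⊢ A [ t ] → Γ ⊢ ∃̇ A
    ∃E   : ∀ {A C} → Γ ⊢ ∃̇ A → (A ∷ map wkF Γ) ⊢ wkF C → Γ ⊢ C

  _↔IL_ : ∀ {n} → Fm n → Fm n → Set
  A ↔IL B = [] ⊢ A ⇔̇ B

module Submission where

-- The translation M is defined together with M∼ A = (∼A)^M (Defs proves
-- M∼ A ≡ M (∼ A)), and an inspection of the six clauses shows a purely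
-- syntactic dichotomy: for every A, either (∼A)^M is literally ¬A^M
-- (A an atom, a disjunction or an existential), or A^M is literally
-- ¬(∼A)^M (A a negated atom, a conjunction or a universal).
-- In the first case the claim is  ¬¬A^M ↔ ¬¬A^M , an instance of
-- reflexivity of ⇔; in the second, writing Y = (∼A)^M, it is  ¬Y ↔ ¬¬¬Y ,
-- the intuitionistic reduction of triple negation.

open import Defs
open import Data.List using (List; _∷_)
open import Data.List.Relation.Unary.Any using (here; there)
open import Data.Sum using (_⊎_; inj₁; inj₂)
open import Relation.Binary.PropositionalEquality using (_≡_; refl; sym; subst)

module _ (S : Signature) where
  open Syntax S

  hyp₀ : ∀ {n} {Γ : List (Fm n)} {A : Fm n} → (A ∷ Γ) ⊢ A
  hyp₀ = hyp (here refl)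

  hyp₁ : ∀ {n} {Γ : List (Fm n)} {A B : Fm n} → (B ∷ A ∷ Γ) ⊢ A
  hyp₁ = hyp (there (here refl))

  ⇔-refl : ∀ {n} {Γ : List (Fm n)} (X : Fm n) → Γ ⊢ X ⇔̇ X
  ⇔-refl X = ∧I (⇒I hyp₀) (⇒I hyp₀)

  ¬¬-intro : ∀ {n} {Γ : List (Fm n)} {Y : Fm n} → Γ ⊢ Y ⇒ ¬̇ ¬̇ Y
  ¬¬-intro = ⇒I (⇒I (⇒E hyp₀ hyp₁))

  ¬¬¬-reduce : ∀ {n} {Γ : List (Fm n)} (Y : Fm n) → Γ ⊢ (¬̇ Y) ⇔̇ (¬̇ ¬̇ ¬̇ Y)
  ¬¬¬-reduce Y = ∧I ¬¬-intro (⇒I (⇒I (⇒E hyp₁ (⇒E ¬¬-intro hyp₀))))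

  negation-dichotomy : ∀ {n} (A : CFm n) → M∼ A ≡ ¬̇ M A ⊎ M A ≡ ¬̇ M∼ A
  negation-dichotomy (pos P ts) = inj₁ refl
  negation-dichotomy (neg P ts) = inj₂ refl
  negation-dichotomy (A ∧ᶜ B)   = inj₂ refl
  negation-dichotomy (A ∨ᶜ B)   = inj₁ refl
  negation-dichotomy (∀ᶜ A)     = inj₂ refl
  negation-dichotomy (∃ᶜ A)     = inj₁ refl

  ¬M∼⇔¬¬M : ∀ {n} (A : CFm n) → (¬̇ M∼ A) ↔IL (¬̇ ¬̇ M A)
  ¬M∼⇔¬¬M A with negation-dichotomy A
  ... | inj₁ M∼A≡¬MA = subst (λ X → (¬̇ X) ↔IL (¬̇ ¬̇ M A)) (sym M∼A≡¬MA) (⇔-refl _)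
  ... | inj₂ MA≡¬M∼A = subst (λ X → (¬̇ M∼ A) ↔IL (¬̇ ¬̇ X)) (sym MA≡¬M∼A) (¬¬¬-reduce _)

lemma19 : (S : Signature) → let open Syntax S in
    ∀ {n} (A : CFm n) → (¬̇ M (∼ A)) ↔IL (¬̇ ¬̇ M A)
lemma19 S A = subst (λ X → (¬̇ X) ↔IL (¬̇ ¬̇ M A)) (M∼-correct A) (¬M∼⇔¬¬M S A)
  where open Syntax S
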